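{- For every integer $n\geqslant 4$, $n$ is prime or $n=4$ if and only if $n$ does not divide $(n-3)!$. -}

module Submission where

-- (⇒) A prime dividing m! divides one of the factors 1,…,m (Euclid's
--     lemma), hence is at most m < n; and 4 ∤ 1! = 1.
-- (⇐) If n is composite and n ≠ 4, write n = q·d with 1 < d < n.  Every a
--     with 1 ≤ a ≤ m divides m!, and so does b·a whenever 1 ≤ a < b ≤ m.
--     • If d ≠ q, let a < b be the two factors; then a ≥ 2 gives
--       b + 3 ≤ 2b ≤ a·b = n, i.e. b ≤ m, so n = b·a ∣ m!.
--     • If d = q then d ≥ 3 (d = 2 would give n = 4), so 2d + 3 ≤ 3d ≤ d² = n,
--       i.e. d < 2d ≤ m; hence d·2d ∣ m! and n = d·d ∣ d·2d.

open import Data.Nat using (ℕ; zero; suc; _+_; _*_; _<_; _≤_; _∸_; _!; z≤n; s≤s; _≟_; nonTrivial⇒n>1)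
open import Data.Nat.Properties
open import Data.Nat.Divisibility
open import Data.Nat.Primality using (Prime; Composite; composite; euclidsLemma; ¬prime[1]; prime?; ¬prime⇒composite)
open import Data.Sum using (_⊎_; inj₁; inj₂)
open import Relation.Binary using (tri<; tri≈; tri>)
open import Relation.Binary.PropositionalEquality using (_≡_; _≢_; refl; sym; trans; cong; subst)
open import Relation.Nullary using (¬_; yes; no; contradiction)
open import Function.Bundles using (_⇔_; mk⇔)

prime∣!⇒≤ : ∀ {p} m → Prime p → p ∣ m ! → p ≤ m
prime∣!⇒≤ zero    p-prime p∣1 = contradiction (subst Prime (∣1⇒≡1 p∣1) p-prime) ¬prime[1]
prime∣!⇒≤ (suc m) p-prime p∣m! with euclidsLemma (suc m) (m !) p-prime p∣m!
... | inj₁ p∣1+m = ∣⇒≤ p∣1+m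
... | inj₂ p∣m!  = m≤n⇒m≤1+n (prime∣!⇒≤ m p-prime p∣m!)

prime>⇒∤! : ∀ {p} m → Prime p → m < p → ¬ (p ∣ m !)
prime>⇒∤! m p-prime m<p p∣m! = <⇒≱ m<p (prime∣!⇒≤ m p-prime p∣m!)

-- Every a with 1 ≤ a ≤ m divides m!, since a ∣ a · (a-1)! = a! ∣ m!.
∣! : ∀ {a m} → 1 ≤ a → a ≤ m → a ∣ m !
∣! {suc a} _ a≤m = ∣-trans (m∣m*n (a !)) (m≤n⇒m!∣n! a≤m)

-- The product of two distinct numbers 1 ≤ a < b ≤ m divides m!, since
-- a ∣ (b-1)! gives b · a ∣ b · (b-1)! = b! ∣ m!.
distinct-*∣! : ∀ {a b m} → 1 ≤ a → a < b → b ≤ m → b * a ∣ m !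
distinct-*∣! {b = suc c} 1≤a (s≤s a≤c) b≤m =
  ∣-trans (*-monoʳ-∣ (suc c) (∣! 1≤a a≤c)) (m≤n⇒m!∣n! b≤m)

*-two : ∀ b → b * 2 ≡ b + b
*-two b = trans (*-suc b 1) (cong (b +_) (*-identityʳ b))

*-three : ∀ b → b * 3 ≡ b + (b + b)
*-three b = trans (*-suc b 2) (cong (b +_) (*-two b))

larger-factor≤ : ∀ {a b m} → 2 ≤ a → a < b → b * a ≡ 3 + m → b ≤ m
larger-factor≤ {a} {b} {m} 2≤a a<b ba≡n = +-cancelʳ-≤ 3 b m (begin
  b + 3   ≤⟨ +-monoʳ-≤ b (≤-trans (s≤s 2≤a) a<b) ⟩
  b + b   ≡⟨ sym (*-two b) ⟩
  b * 2   ≤⟨ *-monoʳ-≤ b 2≤a ⟩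
  b * a   ≡⟨ trans ba≡n (+-comm 3 m) ⟩
  m + 3   ∎)
  where open ≤-Reasoning

double-root≤ : ∀ {d m} → 3 ≤ d → d * d ≡ 3 + m → d + d ≤ m
double-root≤ {d} {m} 3≤d dd≡n = +-cancelʳ-≤ 3 (d + d) m (begin
  d + d + 3     ≤⟨ +-monoʳ-≤ (d + d) 3≤d ⟩
  d + d + d     ≡⟨ +-assoc d d d ⟩
  d + (d + d)   ≡⟨ sym (*-three d) ⟩
  d * 3         ≤⟨ *-monoʳ-≤ d 3≤d ⟩
  d * d         ≡⟨ trans dd≡n (+-comm 3 m) ⟩
  m + 3         ∎)
  where open ≤-Reasoning

distinct-factors∣! : ∀ {a b m} → 2 ≤ a → a < b → b * a ≡ 3 + m → 3 + m ∣ m !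
distinct-factors∣! {m = m} 2≤a a<b ba≡n =
  subst (_∣ m !) ba≡n (distinct-*∣! (≤-trans (s≤s z≤n) 2≤a) a<b (larger-factor≤ 2≤a a<b ba≡n))

-- A square of a number ≥ 3 divides (n-3)!: d · d ∣ d · 2d and d < 2d ≤ m.
square∣! : ∀ {d m} → 3 ≤ d → d * d ≡ 3 + m → 3 + m ∣ m !
square∣! {d} {m} 3≤d dd≡n = subst (_∣ m !) dd≡n
  (∣-trans (*-monoʳ-∣ d d∣2d)
    (subst (_∣ m !) (*-comm (d + d) d)
      (distinct-*∣! (≤-trans (s≤s z≤n) 3≤d) d<2d (double-root≤ 3≤d dd≡n))))
  where
  d∣2d : d ∣ d + d
  d∣2d = ∣m∣n⇒∣m+n ∣-refl ∣-refl
  d<2d : d < d + d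
  d<2d = m<m+n d (≤-trans (s≤s z≤n) 3≤d)

cofactor≥2 : ∀ {n q d} → 1 ≤ d → d < n → n ≡ q * d → 2 ≤ q
cofactor≥2 {q = zero}          _   ()  refl
cofactor≥2 {q = suc zero}  {d} _   d<n n≡d = contradiction (trans n≡d (+-identityʳ d)) (>⇒≢ d<n)
cofactor≥2 {q = suc (suc _)}   _   _   _   = s≤s (s≤s z≤n)

composite∣! : ∀ m → Composite (3 + m) → 3 + m ≢ 4 → 3 + m ∣ m !
composite∣! m (composite {d} d<n (divides q n≡qd)) n≢4 with <-cmp d q
... | tri< d<q _ _ = distinct-factors∣! 2≤d d<q (sym n≡qd)
  where 2≤d = nonTrivial⇒n>1 d
... | tri> _ _ q<d = distinct-factors∣! 2≤q q<d (trans (*-comm d q) (sym n≡qd))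
  where 2≤q = cofactor≥2 (≤-trans (s≤s z≤n) (nonTrivial⇒n>1 d)) d<n n≡qd
... | tri≈ _ refl _ = square∣! 3≤d (sym n≡qd)
  where
  d≢2 : d ≢ 2
  d≢2 refl = n≢4 n≡qd
  3≤d : 3 ≤ d
  3≤d = ≤∧≢⇒< (nonTrivial⇒n>1 d) (λ 2≡d → d≢2 (sym 2≡d))

lemma2 : ∀ (n : ℕ) → 4 ≤ n → ((Prime n ⊎ n ≡ 4) ⇔ (¬ (n ∣ (n ∸ 3) !)))
lemma2 0 ()
lemma2 1 (s≤s ())
lemma2 2 (s≤s (s≤s ()))
lemma2 (suc (suc (suc m))) _ = mk⇔ prime-or-4⇒∤ ∤⇒prime-or-4
  where
  n : ℕ
  n = 3 + m

  prime-or-4⇒∤ : Prime n ⊎ n ≡ 4 → ¬ (n ∣ m !)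
  prime-or-4⇒∤ (inj₁ n-prime) = prime>⇒∤! m n-prime (m≤n+m (suc m) 2)
  prime-or-4⇒∤ (inj₂ refl)    = λ 4∣1 → <⇒≱ (s≤s (s≤s z≤n)) (∣⇒≤ 4∣1)

  ∤⇒prime-or-4 : ¬ (n ∣ m !) → Prime n ⊎ n ≡ 4
  ∤⇒prime-or-4 n∤m! with prime? n | n ≟ 4
  ... | yes n-prime | _       = inj₁ n-prime
  ... | no _        | yes n≡4 = inj₂ n≡4
  ... | no ¬prime   | no n≢4  = contradiction (composite∣! m (¬prime⇒composite ¬prime) n≢4) n∤m!
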